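{- Let $t\geq 1$ and let $L$ be an affine sublattice of $\mathbb{Z}^t$. If $L\cap\mathcal{P}^t$ is Zariski dense in $L$, then $\alpha_p(L)\neq 0$ for every prime number $p$.
   Context: A lattice is an additive discrete subgroup of a Euclidean space other than $\{0\}$; an affine sublattice of $\mathbb{Z}^t$ is a translate $a+\Lambda$ of a sublattice $\Lambda\neq\{0\}$ of $\mathbb{Z}^t$. $\mathcal{P}=\{\pm2,\pm3,\pm5,\pm7,\dots\}$ is the set of integers that are primes up to sign. A subset of $\mathbb{Z}^t$ is Zariski closed if it is the set of common zeros in $\mathbb{Z}^t$ of a family of polynomials in $t$ variables; a subset $B\subseteq A\subseteq\mathbb{Z}^t$ is Zariski dense in $A$ if every Zariski closed subset of $\mathbb{Z}^t$ containing $B$ contains $A$. An affine sublattice $L$ of $\mathbb{Z}^t$ is degenerate if $t>1$ and for some $i$ the $i$-th coordinate is constant on $L$ with constant value in $\mathcal{P}$; if $A$ is the set of such indices $i$, the non-degenerate sublattice $L^*$ associated to $L$ is the projection of $L$ to $\prod_{j\notin A}\mathbb{Z}$ (for non-degenerate $L$, $L^*=L$). For a prime $p$, write $\mathbb{Z}_p=\mathbb{Z}/p\mathbb{Z}$. For non-degenerate $L\subseteq\mathbb{Z}^t$, let $L_p$ be the image of $L$ under reduction $\mathbb{Z}^t\to\mathbb{Z}_p^t$ and define the local factor $\alpha_p(L)=\left(\frac{p}{p-1}\right)^t\frac{|L_p\cap(\mathbb{Z}_p^{\times})^t|}{|L_p|}$; for degenerate $L$, $\alpha_p(L):=\alpha_p(L^*)$.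 -}

module Defs where

open import Data.Bool using (Bool; true; false; if_then_else_; _∧_; _∨_; not)
open import Data.Nat as ℕ using (ℕ; zero; suc; _<_; _∸_)
open import Data.Nat.Primality using (Prime; prime?)
open import Data.Integer as ℤ using (ℤ; +_; ∣_∣)
open import Data.Integer.DivMod using (_%ℕ_)
open import Data.Rational as ℚ using (ℚ; 0ℚ)
open import Data.List as List using (List; []; _∷_; concatMap; length)
open import Data.Bool.ListAction using (any; all)
open import Data.Vec as Vec using (Vec; []; _∷_; replicate; zipWith; lookup; toList)
open import Data.Fin using (Fin)
open import Data.Product using (Σ; ∃; _×_; _,_)
open import Relation.Binary.PropositionalEquality using (_≡_; _≢_)
open import Relation.Nullary.Decidable using (does)

0ᵥ : ∀ {t} → Vec ℤ t
0ᵥ = replicate _ (+ 0)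

_+ᵥ_ : ∀ {t} → Vec ℤ t → Vec ℤ t → Vec ℤ t
_+ᵥ_ = zipWith ℤ._+_

_·ᵥ_ : ∀ {t} → ℤ → Vec ℤ t → Vec ℤ t
c ·ᵥ v = Vec.map (c ℤ.*_) v

lincomb : ∀ {t k} → Vec ℤ k → Vec (Vec ℤ t) k → Vec ℤ t
lincomb []       []       = 0ᵥ
lincomb (c ∷ cs) (g ∷ gs) = (c ·ᵥ g) +ᵥ lincomb cs gs

-- Affine sublattices  a + Λ,  Λ = ℤ-span of the generators gs.
-- (Every subgroup of ℤ^t is finitely generated, so every affine
-- sublattice arises this way.)

InSpan : ∀ {t k} → Vec (Vec ℤ t) k → Vec ℤ t → Set
InSpan {k = k} gs x = Σ (Vec ℤ k) λ cs → x ≡ lincomb cs gs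

InL : ∀ {t k} → Vec ℤ t → Vec (Vec ℤ t) k → Vec ℤ t → Set
InL {k = k} a gs x = Σ (Vec ℤ k) λ cs → x ≡ a +ᵥ lincomb cs gs

NonTrivial : ∀ {t k} → Vec (Vec ℤ t) k → Set
NonTrivial gs = ∃ λ y → InSpan gs y × y ≢ 0ᵥ

IsP : ℤ → Set
IsP z = Prime ∣ z ∣

AllP : ∀ {t} → Vec ℤ t → Set
AllP x = ∀ i → IsP (lookup x i)

Poly : ℕ → Set
Poly t = List (ℤ × Vec ℕ t)

evalMono : ∀ {t} → Vec ℕ t → Vec ℤ t → ℤ
evalMono []       []       = + 1
evalMono (e ∷ es) (x ∷ xs) = (x ℤ.^ e) ℤ.* evalMono es xs

eval : ∀ {t} → Poly t → Vec ℤ t → ℤ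
eval []             x = + 0
eval ((c , e) ∷ fs) x = c ℤ.* evalMono e x ℤ.+ eval fs x

ZeroSet : ∀ {t} → (Poly t → Set) → Vec ℤ t → Set
ZeroSet F x = ∀ f → F f → eval f x ≡ + 0

ZariskiDense : ∀ {t} → (Vec ℤ t → Set) → (Vec ℤ t → Set) → Set₁
ZariskiDense {t} B A =
  (F : Poly t → Set) → (∀ x → B x → ZeroSet F x) → ∀ x → A x → ZeroSet F x

-- reduction of an integer mod p, as a representative in [0, p)
-- (p = 0 never occurs below since p is prime)
modP : ℕ → ℤ → ℕ
modP zero    z = 0
modP (suc q) z = z %ℕ suc q

redV : ∀ {t} → ℕ → Vec ℤ t → Vec ℕ t
redV p = Vec.map (modP p)

-- all vectors in [0,n)^t, i.e. an enumeration of ℤ_n^t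
allVecs : ℕ → (t : ℕ) → List (Vec ℕ t)
allVecs n zero    = [] ∷ []
allVecs n (suc t) = concatMap (λ i → List.map (i ∷_) (allVecs n t)) (List.upTo n)

eqVec : ∀ {t} → Vec ℕ t → Vec ℕ t → Bool
eqVec []       []       = true
eqVec (x ∷ xs) (y ∷ ys) = does (x ℕ.≟ y) ∧ eqVec xs ys

-- L_p = image of L = a + span(gs) under ℤ^t → ℤ_p^t.  Since reduction is
-- a group homomorphism, L_p = { red(a + Σ c_j g_j) : c ∈ [0,p)^k }.
-- This list enumerates L_p (with repetitions).
LpList : ∀ {t k} → ℕ → Vec ℤ t → Vec (Vec ℤ t) k → List (Vec ℕ t)
LpList {k = k} p a gs =
  List.map (λ c → redV p (a +ᵥ lincomb (Vec.map +_ c) gs)) (allVecs p k)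

inLp : ∀ {t k} → ℕ → Vec ℤ t → Vec (Vec ℤ t) k → Vec ℕ t → Bool
inLp p a gs x = any (eqVec x) (LpList p a gs)

-- x ∈ (ℤ_p^×)^t  (p prime: units are the nonzero residues)
unitVec : ∀ {t} → Vec ℕ t → Bool
unitVec x = all (λ xi → not (does (xi ℕ.≟ 0))) (toList x)

countB : ∀ {A : Set} → (A → Bool) → List A → ℕ
countB P []       = 0
countB P (x ∷ xs) = if P x then suc (countB P xs) else countB P xs

cardLp : ∀ {t k} → ℕ → Vec ℤ t → Vec (Vec ℤ t) k → ℕ
cardLp {t} p a gs = countB (inLp p a gs) (allVecs p t)

cardLpUnits : ∀ {t k} → ℕ → Vec ℤ t → Vec (Vec ℤ t) k → ℕ
cardLpUnits {t} p a gs =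
  countB (λ x → inLp p a gs x ∧ unitVec x) (allVecs p t)

-- n / d in ℚ (d = 0 never occurs below: |L_p| ≥ 1 and p ≥ 2)
frac : ℕ → ℕ → ℚ
frac n zero    = 0ℚ
frac n (suc d) = (+ n) ℚ./ suc d

αnd : ∀ {t k} → ℕ → Vec ℤ t → Vec (Vec ℤ t) k → ℚ
αnd {t} p a gs =
  frac (p ℕ.^ t ℕ.* cardLpUnits p a gs) ((p ∸ 1) ℕ.^ t ℕ.* cardLp p a gs)

-- is the i-th coordinate constant on L = a + span gs?  This holds iff
-- every generator has i-th coordinate 0 (then the constant is a_i).
constCoord : ∀ {t k} → Vec (Vec ℤ t) k → Fin t → Bool
constCoord gs i = all (λ g → does (lookup g i ℤ.≟ + 0)) (toList gs)

isPb : ℤ → Bool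
isPb z = does (prime? ∣ z ∣)

-- the set A of indices: coordinate constant on L with value in 𝒫
-- (only when t > 1); keepVec marks the indices NOT in A.
inA : ∀ {t k} → Vec ℤ t → Vec (Vec ℤ t) k → Fin t → Bool
inA {t} a gs i = does (1 ℕ.<? t) ∧ constCoord gs i ∧ isPb (lookup a i)

keepVec : ∀ {t k} → Vec ℤ t → Vec (Vec ℤ t) k → Vec Bool t
keepVec a gs = Vec.tabulate (λ i → not (inA a gs i))

cnt : ∀ {t} → Vec Bool t → ℕ
cnt []           = 0
cnt (true ∷ bs)  = suc (cnt bs)
cnt (false ∷ bs) = cnt bs

proj : ∀ {A : Set} {t} (bs : Vec Bool t) → Vec A t → Vec A (cnt bs)
proj []           []       = []
proj (true ∷ bs)  (x ∷ xs) = x ∷ proj bs xs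
proj (false ∷ bs) (x ∷ xs) = proj bs xs

-- α_p(L) := α_p(L*), where L* = projection of L; the image of
-- a + span(gs) under the (linear) projection is proj a + span(proj gs).
-- For non-degenerate L, nothing is removed and L* = L.
α : ∀ {t k} → ℕ → Vec ℤ t → Vec (Vec ℤ t) k → ℚ
α p a gs = αnd p (proj bs a) (Vec.map (proj bs) gs)
  where bs = keepVec a gs

-- If α_p(L) = 0, no point of L*_p has all coordinates nonzero mod p, so every point
-- x ∈ L has a coordinate i kept in L* with p ∣ x_i; when x ∈ 𝒫^t this forces x_i = ±p.
-- Hence ∏ (x_i² − p²) over the kept coordinates vanishes on L ∩ 𝒫^t, and by Zariski
-- density on all of L. But a kept coordinate is either non-constant on L, or constant
-- with a value outside 𝒫 (a constant value in 𝒫 is removed when t > 1, and for t = 1 a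
-- constant coordinate would force Λ = {0}). Choosing the coefficients of a point of L
-- from the last to the first, each large compared with what the later ones contribute,
-- we find y ∈ L none of whose kept coordinates is ±p, so the product does not vanish at y.
module Submission where

open import Data.Bool using (Bool; true; false; T; not)
open import Data.Bool.Properties using (T-∧; T-≡; T-not-≡)
open import Data.Fin using (Fin; zero; suc)
open import Data.Integer as ℤ using (ℤ; +_; -_; 0ℤ; 1ℤ; _+_; _-_; _*_; _^_; ∣_∣)
open import Data.Integer.DivMod using (_/ℕ_; n%ℕd<d; a≡a%ℕn+[a/ℕn]*n)
open import Data.Integer.Divisibility.Signed using (_∣_; divides; ∣-refl; ∣m∣n⇒∣m+n; ∣m⇒∣m*n; ∣⇒∣ᵤ)
open import Data.Integer.GCD using (gcd)
open import Data.Integer.Properties as ℤP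
  using ( i*j≡0⇒i≡0∨j≡0; *-zeroˡ; *-zeroʳ; +∣i∣≡i⊎+∣i∣≡-i; i≡j⇒i-j≡0; i-j≡0⇒i≡j
        ; neg-involutive; ∣-i∣≡∣i∣; +-inverseˡ)
open import Data.Integer.Tactic.RingSolver using (solve-∀)
open import Algebra.Properties.CommutativeSemigroup ℤP.*-commutativeSemigroup using (interchange)
open import Algebra.Properties.CommutativeSemigroup ℤP.+-commutativeSemigroup
  using () renaming (x∙yz≈y∙xz to x+[y+z]≡y+[x+z])
open import Data.List as List using (List; []; _∷_; _++_)
open import Data.List.Extrema.Nat using (max; xs≤max)
open import Data.List.Membership.Propositional using (_∈_; lose)
open import Data.List.Membership.Propositional.Properties using (∈-map⁺; ∈-concat⁺′; ∈-upTo⁺; ∈-tabulate⁺)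
import Data.List.Relation.Unary.All as LAll
open import Data.List.Relation.Unary.Any using (here; there)
open import Data.List.Relation.Unary.Any.Properties using (any⁺)
open import Data.Nat as ℕ using (ℕ; zero; suc; _≤_; NonZero)
import Data.Nat.Properties as ℕP
open import Data.Nat.Primality using (Prime; prime?; prime⇒irreducible; prime⇒nonTrivial)
open import Data.Product using (∃; _×_; _,_; proj₁; proj₂; map₂)
open import Data.Rational as ℚ using (0ℚ; ↥_)
open import Data.Rational.Properties using (↥-/; p≡0⇒↥p≡0)
open import Data.Sum using (inj₁; inj₂)
open import Data.Unit using (tt)
open import Data.Vec as Vec using (Vec; []; _∷_; lookup; replicate; zipWith)
import Data.Vec.Properties as VP
import Data.Vec.Relation.Unary.All as VAll
open import Data.Vec.Relation.Unary.All using ([]; _∷_)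
open import Function using (_∘_)
open import Function.Bundles using (_⇔_; mk⇔; Equivalence)
open import Relation.Binary.PropositionalEquality
open import Relation.Nullary using (¬_; contradiction; yes; no)
open import Relation.Nullary.Decidable using (dec-true)

open import Defs

private variable
  t k : ℕ
  A : Set

infixl 7 _*ₘ_ _*ₚ_

_*ₘ_ : ℤ × Vec ℕ t → ℤ × Vec ℕ t → ℤ × Vec ℕ t
(c , e) *ₘ (d , f) = c * d , zipWith ℕ._+_ e f

_*ₚ_ : Poly t → Poly t → Poly t
[]      *ₚ g = []
(m ∷ f) *ₚ g = List.map (m *ₘ_) g ++ f *ₚ g

evalMono-+ : (e f : Vec ℕ t) (x : Vec ℤ t) →
             evalMono (zipWith ℕ._+_ e f) x ≡ evalMono e x * evalMono f x
evalMono-+ []      []      []       = refl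
evalMono-+ (a ∷ e) (b ∷ f) (x ∷ xs) = begin
  x ^ (a ℕ.+ b) * evalMono (zipWith ℕ._+_ e f) xs
    ≡⟨ cong₂ _*_ (ℤP.^-distribˡ-+-* x a b) (evalMono-+ e f xs) ⟩
  x ^ a * x ^ b * (evalMono e xs * evalMono f xs)
    ≡⟨ interchange (x ^ a) (x ^ b) (evalMono e xs) (evalMono f xs) ⟩
  x ^ a * evalMono e xs * (x ^ b * evalMono f xs) ∎
  where open ≡-Reasoning

eval-++ : (f g : Poly t) (x : Vec ℤ t) → eval (f ++ g) x ≡ eval f x + eval g x
eval-++ []            g x = sym (ℤP.+-identityˡ (eval g x))
eval-++ ((c , e) ∷ f) g x = begin
  c * evalMono e x + eval (f ++ g) x       ≡⟨ cong (_+_ (c * evalMono e x)) (eval-++ f g x) ⟩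
  c * evalMono e x + (eval f x + eval g x) ≡⟨ ℤP.+-assoc (c * evalMono e x) (eval f x) (eval g x) ⟨
  c * evalMono e x + eval f x + eval g x   ∎
  where open ≡-Reasoning

eval-map-*ₘ : (c : ℤ) (e : Vec ℕ t) (g : Poly t) (x : Vec ℤ t) →
              eval (List.map ((c , e) *ₘ_) g) x ≡ c * evalMono e x * eval g x
eval-map-*ₘ c e []            x = sym (*-zeroʳ (c * evalMono e x))
eval-map-*ₘ c e ((d , f) ∷ g) x = begin
  c * d * evalMono (zipWith ℕ._+_ e f) x + eval (List.map ((c , e) *ₘ_) g) x
    ≡⟨ cong₂ _+_ (cong (c * d *_) (evalMono-+ e f x)) (eval-map-*ₘ c e g x) ⟩
  c * d * (evalMono e x * evalMono f x) + c * evalMono e x * eval g x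
    ≡⟨ cong (_+ c * evalMono e x * eval g x) (interchange c d (evalMono e x) (evalMono f x)) ⟩
  c * evalMono e x * (d * evalMono f x) + c * evalMono e x * eval g x
    ≡⟨ ℤP.*-distribˡ-+ (c * evalMono e x) (d * evalMono f x) (eval g x) ⟨
  c * evalMono e x * (d * evalMono f x + eval g x) ∎
  where open ≡-Reasoning

eval-*ₚ : (f g : Poly t) (x : Vec ℤ t) → eval (f *ₚ g) x ≡ eval f x * eval g x
eval-*ₚ []            g x = refl
eval-*ₚ ((c , e) ∷ f) g x = begin
  eval (List.map ((c , e) *ₘ_) g ++ f *ₚ g) x
    ≡⟨ eval-++ (List.map ((c , e) *ₘ_) g) (f *ₚ g) x ⟩
  eval (List.map ((c , e) *ₘ_) g) x + eval (f *ₚ g) x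
    ≡⟨ cong₂ _+_ (eval-map-*ₘ c e g x) (eval-*ₚ f g x) ⟩
  c * evalMono e x * eval g x + eval f x * eval g x
    ≡⟨ ℤP.*-distribʳ-+ (eval g x) (c * evalMono e x) (eval f x) ⟨
  (c * evalMono e x + eval f x) * eval g x ∎
  where open ≡-Reasoning

weaken : Poly t → Poly (suc t)
weaken = List.map (map₂ (0 ∷_))

eval-weaken : (f : Poly t) (x : ℤ) (xs : Vec ℤ t) → eval (weaken f) (x ∷ xs) ≡ eval f xs
eval-weaken []            x xs = refl
eval-weaken ((c , e) ∷ f) x xs =
  cong₂ (λ m r → c * m + r) (ℤP.*-identityˡ (evalMono e xs)) (eval-weaken f x xs)

evalMono-0 : (x : Vec ℤ t) → evalMono (replicate t 0) x ≡ 1ℤ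
evalMono-0 []       = refl
evalMono-0 (x ∷ xs) = cong (1ℤ *_) (evalMono-0 xs)

x₀²-p² : ℕ → Poly (suc t)
x₀²-p² p = (1ℤ , 2 ∷ replicate _ 0) ∷ (- (+ p * + p) , 0 ∷ replicate _ 0) ∷ []

eval-x₀²-p² : (p : ℕ) (x : ℤ) (xs : Vec ℤ t) → eval (x₀²-p² p) (x ∷ xs) ≡ (x - + p) * (x + + p)
eval-x₀²-p² p x xs rewrite evalMono-0 xs = difference-of-squares x (+ p)
  where
  difference-of-squares : ∀ x q →
    1ℤ * (x * (x * 1ℤ) * 1ℤ) + (- (q * q) * (1ℤ * 1ℤ) + 0ℤ) ≡ (x - q) * (x + q)
  difference-of-squares = solve-∀

[x-p][x+p]≡0⇔∣x∣≡p : (x : ℤ) (p : ℕ) → (x - + p) * (x + + p) ≡ 0ℤ ⇔ ∣ x ∣ ≡ p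
[x-p][x+p]≡0⇔∣x∣≡p x p = mk⇔ root⇒∣x∣≡p ∣x∣≡p⇒root
  where
  root⇒∣x∣≡p : (x - + p) * (x + + p) ≡ 0ℤ → ∣ x ∣ ≡ p
  root⇒∣x∣≡p e with i*j≡0⇒i≡0∨j≡0 (x - + p) e
  ... | inj₁ x-p≡0 = cong ∣_∣ (i-j≡0⇒i≡j x (+ p) x-p≡0)
  ... | inj₂ x+p≡0 = begin
    ∣ x ∣       ≡⟨ cong ∣_∣ (i-j≡0⇒i≡j x (- + p) x--p≡0) ⟩
    ∣ - + p ∣   ≡⟨ ∣-i∣≡∣i∣ (+ p) ⟩
    p           ∎
    where
    open ≡-Reasoning
    x--p≡0 : x - (- + p) ≡ 0ℤ
    x--p≡0 = trans (cong (_+_ x) (neg-involutive (+ p))) x+p≡0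
  ∣x∣≡p⇒root : ∣ x ∣ ≡ p → (x - + p) * (x + + p) ≡ 0ℤ
  ∣x∣≡p⇒root refl with +∣i∣≡i⊎+∣i∣≡-i x
  ... | inj₁ +∣x∣≡x  =
    trans (cong (_* (x + + ∣ x ∣)) (i≡j⇒i-j≡0 (sym +∣x∣≡x))) (*-zeroˡ (x + + ∣ x ∣))
  ... | inj₂ +∣x∣≡-x = trans (cong ((x - + ∣ x ∣) *_) x+∣x∣≡0) (*-zeroʳ (x - + ∣ x ∣))
    where
    x+∣x∣≡0 : x + + ∣ x ∣ ≡ 0ℤ
    x+∣x∣≡0 = trans (cong (_+ + ∣ x ∣) (trans (sym (neg-involutive x)) (cong -_ (sym +∣x∣≡-x))))
                    (+-inverseˡ (+ ∣ x ∣))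

∏xᵢ²-p² : ℕ → Vec Bool t → Poly t
∏xᵢ²-p² p []           = (1ℤ , []) ∷ []
∏xᵢ²-p² p (false ∷ bs) = weaken (∏xᵢ²-p² p bs)
∏xᵢ²-p² p (true ∷ bs)  = x₀²-p² p *ₚ weaken (∏xᵢ²-p² p bs)

eval-∏xᵢ²-p²-true : (p : ℕ) (bs : Vec Bool t) (x : ℤ) (xs : Vec ℤ t) →
  eval (∏xᵢ²-p² p (true ∷ bs)) (x ∷ xs) ≡ (x - + p) * (x + + p) * eval (∏xᵢ²-p² p bs) xs
eval-∏xᵢ²-p²-true p bs x xs = begin
  eval (x₀²-p² p *ₚ weaken (∏xᵢ²-p² p bs)) (x ∷ xs)
    ≡⟨ eval-*ₚ (x₀²-p² p) (weaken (∏xᵢ²-p² p bs)) (x ∷ xs) ⟩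
  eval (x₀²-p² p) (x ∷ xs) * eval (weaken (∏xᵢ²-p² p bs)) (x ∷ xs)
    ≡⟨ cong₂ _*_ (eval-x₀²-p² p x xs) (eval-weaken (∏xᵢ²-p² p bs) x xs) ⟩
  (x - + p) * (x + + p) * eval (∏xᵢ²-p² p bs) xs ∎
  where open ≡-Reasoning

∏xᵢ²-p²-root : (p : ℕ) (bs : Vec Bool t) (x : Vec ℤ t) (i : Fin t) →
  T (lookup bs i) → ∣ lookup x i ∣ ≡ p → eval (∏xᵢ²-p² p bs) x ≡ 0ℤ
∏xᵢ²-p²-root p (true ∷ bs) (x ∷ xs) zero _ ∣x∣≡p = begin
  eval (∏xᵢ²-p² p (true ∷ bs)) (x ∷ xs)
    ≡⟨ eval-∏xᵢ²-p²-true p bs x xs ⟩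
  (x - + p) * (x + + p) * eval (∏xᵢ²-p² p bs) xs
    ≡⟨ cong (_* _) (Equivalence.from ([x-p][x+p]≡0⇔∣x∣≡p x p) ∣x∣≡p) ⟩
  0ℤ * eval (∏xᵢ²-p² p bs) xs
    ≡⟨ *-zeroˡ (eval (∏xᵢ²-p² p bs) xs) ⟩
  0ℤ ∎
  where open ≡-Reasoning
∏xᵢ²-p²-root p (true ∷ bs) (x ∷ xs) (suc i) marked ∣xᵢ∣≡p = begin
  eval (∏xᵢ²-p² p (true ∷ bs)) (x ∷ xs)
    ≡⟨ eval-∏xᵢ²-p²-true p bs x xs ⟩
  (x - + p) * (x + + p) * eval (∏xᵢ²-p² p bs) xs
    ≡⟨ cong ((x - + p) * (x + + p) *_) (∏xᵢ²-p²-root p bs xs i marked ∣xᵢ∣≡p) ⟩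
  (x - + p) * (x + + p) * 0ℤ
    ≡⟨ *-zeroʳ ((x - + p) * (x + + p)) ⟩
  0ℤ ∎
  where open ≡-Reasoning
∏xᵢ²-p²-root p (false ∷ bs) (x ∷ xs) (suc i) marked ∣xᵢ∣≡p =
  trans (eval-weaken (∏xᵢ²-p² p bs) x xs) (∏xᵢ²-p²-root p bs xs i marked ∣xᵢ∣≡p)

∏xᵢ²-p²≢0 : (p : ℕ) (bs : Vec Bool t) (x : Vec ℤ t) →
  (∀ i → T (lookup bs i) → ∣ lookup x i ∣ ≢ p) → eval (∏xᵢ²-p² p bs) x ≢ 0ℤ
∏xᵢ²-p²≢0 p []           []       _      ()
∏xᵢ²-p²≢0 p (false ∷ bs) (x ∷ xs) avoids e =
  ∏xᵢ²-p²≢0 p bs xs (λ i → avoids (suc i)) (trans (sym (eval-weaken (∏xᵢ²-p² p bs) x xs)) e)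
∏xᵢ²-p²≢0 p (true ∷ bs)  (x ∷ xs) avoids e
  with i*j≡0⇒i≡0∨j≡0 ((x - + p) * (x + + p)) (trans (sym (eval-∏xᵢ²-p²-true p bs x xs)) e)
... | inj₁ root = avoids zero _ (Equivalence.to ([x-p][x+p]≡0⇔∣x∣≡p x p) root)
... | inj₂ rest = ∏xᵢ²-p²≢0 p bs xs (λ i → avoids (suc i)) rest

column : Vec (Vec ℤ t) k → Fin t → Vec ℤ k
column gs i = Vec.map (λ g → lookup g i) gs

dot : Vec ℤ k → Vec ℤ k → ℤ
dot []       []       = 0ℤ
dot (c ∷ cs) (w ∷ ws) = c * w + dot cs ws

dot-0ᵥ : (cs : Vec ℤ k) → dot cs 0ᵥ ≡ 0ℤ
dot-0ᵥ []       = refl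
dot-0ᵥ (c ∷ cs) = cong₂ _+_ (*-zeroʳ c) (dot-0ᵥ cs)

lookup-lincomb : (cs : Vec ℤ k) (gs : Vec (Vec ℤ t) k) (i : Fin t) →
                 lookup (lincomb cs gs) i ≡ dot cs (column gs i)
lookup-lincomb []       []       i = VP.lookup-replicate i 0ℤ
lookup-lincomb (c ∷ cs) (g ∷ gs) i = begin
  lookup ((c ·ᵥ g) +ᵥ lincomb cs gs) i         ≡⟨ VP.lookup-zipWith _+_ i (c ·ᵥ g) (lincomb cs gs) ⟩
  lookup (c ·ᵥ g) i + lookup (lincomb cs gs) i ≡⟨ cong₂ _+_ (VP.lookup-map i (c *_) g) (lookup-lincomb cs gs i) ⟩
  c * lookup g i + dot cs (column gs i)        ∎
  where open ≡-Reasoning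

lookup-affine : (a : Vec ℤ t) (cs : Vec ℤ k) (gs : Vec (Vec ℤ t) k) (i : Fin t) →
                lookup (a +ᵥ lincomb cs gs) i ≡ lookup a i + dot cs (column gs i)
lookup-affine a cs gs i =
  trans (VP.lookup-zipWith _+_ i a (lincomb cs gs)) (cong (_+_ (lookup a i)) (lookup-lincomb cs gs i))

modP-< : ∀ p .{{_ : NonZero p}} z → modP p z ℕ.< p
modP-< (suc q) z = n%ℕd<d z (suc q)

modP-decomp : ∀ p .{{_ : NonZero p}} z → z ≡ + modP p z + (z /ℕ p) * + p
modP-decomp (suc q) z = a≡a%ℕn+[a/ℕn]*n z (suc q)

modP≡0⇒∣ : ∀ p .{{_ : NonZero p}} z → modP p z ≡ 0 → + p ∣ z
modP≡0⇒∣ p z r≡0 = divides (z /ℕ p)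
  (trans (modP-decomp p z) (trans (cong (λ r → + r + (z /ℕ p) * + p) r≡0) (ℤP.+-identityˡ _)))

dot-redV : ∀ p .{{_ : NonZero p}} (cs w : Vec ℤ k) →
  dot cs w ≡ dot (Vec.map +_ (redV p cs)) w + + p * dot (Vec.map (_/ℕ p) cs) w
dot-redV p []       []       = sym (trans (ℤP.+-identityˡ (+ p * 0ℤ)) (*-zeroʳ (+ p)))
dot-redV p (c ∷ cs) (w ∷ ws) = begin
  c * w + dot cs ws
    ≡⟨ cong₂ (λ c′ d → c′ * w + d) (modP-decomp p c) (dot-redV p cs ws) ⟩
  (+ modP p c + (c /ℕ p) * + p) * w + (dot R ws + + p * dot Q ws)
    ≡⟨ regroup (+ modP p c) (c /ℕ p) (+ p) w (dot R ws) (dot Q ws) ⟩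
  (+ modP p c * w + dot R ws) + + p * ((c /ℕ p) * w + dot Q ws) ∎
  where
  open ≡-Reasoning
  R = Vec.map +_ (redV p cs)
  Q = Vec.map (_/ℕ p) cs
  regroup : ∀ r q p w d e → (r + q * p) * w + (d + p * e) ≡ (r * w + d) + p * (q * w + e)
  regroup = solve-∀

∣-affine-redV : ∀ p .{{_ : NonZero p}} (a : Vec ℤ t) (cs : Vec ℤ k) gs i →
  + p ∣ lookup (a +ᵥ lincomb (Vec.map +_ (redV p cs)) gs) i →
  + p ∣ lookup (a +ᵥ lincomb cs gs) i
∣-affine-redV p a cs gs i p∣x′ᵢ =
  subst (+ p ∣_) (sym xᵢ≡x′ᵢ+p*D) (∣m∣n⇒∣m+n p∣x′ᵢ (∣m⇒∣m*n D ∣-refl))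
  where
  open ≡-Reasoning
  col = column gs i
  R = Vec.map +_ (redV p cs)
  D = dot (Vec.map (_/ℕ p) cs) col
  xᵢ≡x′ᵢ+p*D : lookup (a +ᵥ lincomb cs gs) i ≡ lookup (a +ᵥ lincomb R gs) i + + p * D
  xᵢ≡x′ᵢ+p*D = begin
    lookup (a +ᵥ lincomb cs gs) i        ≡⟨ lookup-affine a cs gs i ⟩
    lookup a i + dot cs col              ≡⟨ cong (_+_ (lookup a i)) (dot-redV p cs col) ⟩
    lookup a i + (dot R col + + p * D)   ≡⟨ ℤP.+-assoc (lookup a i) (dot R col) (+ p * D) ⟨
    lookup a i + dot R col + + p * D     ≡⟨ cong (_+ + p * D) (lookup-affine a R gs i) ⟨
    lookup (a +ᵥ lincomb R gs) i + + p * D ∎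

proj-+ᵥ : (bs : Vec Bool t) (u v : Vec ℤ t) → proj bs (u +ᵥ v) ≡ proj bs u +ᵥ proj bs v
proj-+ᵥ []           []      []      = refl
proj-+ᵥ (true ∷ bs)  (x ∷ u) (y ∷ v) = cong (x + y ∷_) (proj-+ᵥ bs u v)
proj-+ᵥ (false ∷ bs) (x ∷ u) (y ∷ v) = proj-+ᵥ bs u v

proj-·ᵥ : (bs : Vec Bool t) (c : ℤ) (v : Vec ℤ t) → proj bs (c ·ᵥ v) ≡ c ·ᵥ proj bs v
proj-·ᵥ []           c []      = refl
proj-·ᵥ (true ∷ bs)  c (y ∷ v) = cong (c * y ∷_) (proj-·ᵥ bs c v)
proj-·ᵥ (false ∷ bs) c (y ∷ v) = proj-·ᵥ bs c v

proj-0ᵥ : (bs : Vec Bool t) → proj bs 0ᵥ ≡ 0ᵥ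
proj-0ᵥ []           = refl
proj-0ᵥ (true ∷ bs)  = cong (0ℤ ∷_) (proj-0ᵥ bs)
proj-0ᵥ (false ∷ bs) = proj-0ᵥ bs

proj-lincomb : (bs : Vec Bool t) (cs : Vec ℤ k) (gs : Vec (Vec ℤ t) k) →
               proj bs (lincomb cs gs) ≡ lincomb cs (Vec.map (proj bs) gs)
proj-lincomb bs []       []       = proj-0ᵥ bs
proj-lincomb bs (c ∷ cs) (g ∷ gs) = begin
  proj bs ((c ·ᵥ g) +ᵥ lincomb cs gs)              ≡⟨ proj-+ᵥ bs (c ·ᵥ g) (lincomb cs gs) ⟩
  proj bs (c ·ᵥ g) +ᵥ proj bs (lincomb cs gs)      ≡⟨ cong₂ _+ᵥ_ (proj-·ᵥ bs c g) (proj-lincomb bs cs gs) ⟩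
  (c ·ᵥ proj bs g) +ᵥ lincomb cs (Vec.map (proj bs) gs) ∎
  where open ≡-Reasoning

proj-affine : (bs : Vec Bool t) (a : Vec ℤ t) (cs : Vec ℤ k) (gs : Vec (Vec ℤ t) k) →
  proj bs (a +ᵥ lincomb cs gs) ≡ proj bs a +ᵥ lincomb cs (Vec.map (proj bs) gs)
proj-affine bs a cs gs = trans (proj-+ᵥ bs a (lincomb cs gs)) (cong (proj bs a +ᵥ_) (proj-lincomb bs cs gs))

lookup-proj : (bs : Vec Bool t) (x : Vec A t) (j : Fin (cnt bs)) →
              ∃ λ i → T (lookup bs i) × lookup (proj bs x) j ≡ lookup x i
lookup-proj (true ∷ bs)  (x ∷ xs) zero    = zero , tt , refl
lookup-proj (true ∷ bs)  (x ∷ xs) (suc j) = let i , marked , e = lookup-proj bs xs j in suc i , marked , e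
lookup-proj (false ∷ bs) (x ∷ xs) j       = let i , marked , e = lookup-proj bs xs j in suc i , marked , e

redV-< : ∀ p .{{_ : NonZero p}} (x : Vec ℤ t) → VAll.All (ℕ._< p) (redV p x)
redV-< p []       = []
redV-< p (z ∷ x) = modP-< p z ∷ redV-< p x

T-eqVec-refl : (v : Vec ℕ t) → T (eqVec v v)
T-eqVec-refl []      = tt
T-eqVec-refl (x ∷ v) = Equivalence.from T-∧ (ℕP.≡⇒≡ᵇ x x refl , T-eqVec-refl v)

allVecs-complete : ∀ n {t} {v : Vec ℕ t} → VAll.All (ℕ._< n) v → v ∈ allVecs n t
allVecs-complete n                      []            = here refl
allVecs-complete n {suc t} {v = i ∷ v} (i<n ∷ v<n) =
  ∈-concat⁺′ (∈-map⁺ (i ∷_) (allVecs-complete n v<n))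
             (∈-map⁺ (λ j → List.map (j ∷_) (allVecs n t)) (∈-upTo⁺ i<n))

countB≡0⇒¬T : (P : A → Bool) (xs : List A) {x : A} → countB P xs ≡ 0 → x ∈ xs → ¬ T (P x)
countB≡0⇒¬T P (y ∷ xs) count≡0 x∈ Px with P y in Py
countB≡0⇒¬T P (y ∷ xs) ()      x∈          Px | true
countB≡0⇒¬T P (y ∷ xs) count≡0 (here refl) Px | false = subst T Py Px
countB≡0⇒¬T P (y ∷ xs) count≡0 (there x∈)  Px | false = countB≡0⇒¬T P xs count≡0 x∈ Px

reduced-∈Lp : ∀ p .{{_ : NonZero p}} (a : Vec ℤ t) (gs : Vec (Vec ℤ t) k) {c : Vec ℕ k} →
  VAll.All (ℕ._< p) c →
  let x = redV p (a +ᵥ lincomb (Vec.map +_ c) gs) in x ∈ allVecs p t × T (inLp p a gs x)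
reduced-∈Lp p a gs {c} c<p =
  allVecs-complete p (redV-< p (a +ᵥ lincomb (Vec.map +_ c) gs)) ,
  any⁺ (eqVec x) (lose (∈-map⁺ (λ c → redV p (a +ᵥ lincomb (Vec.map +_ c) gs)) (allVecs-complete p c<p))
                       (T-eqVec-refl x))
  where x = redV p (a +ᵥ lincomb (Vec.map +_ c) gs)

cardLp≢0 : ∀ p .{{_ : NonZero p}} (a : Vec ℤ t) (gs : Vec (Vec ℤ t) k) → cardLp p a gs ≢ 0
cardLp≢0 {k = k} p a gs cardLp≡0 =
  let x∈allVecs , x∈Lp = reduced-∈Lp p a gs (redV-< p (replicate k 0ℤ))
  in countB≡0⇒¬T (inLp p a gs) _ cardLp≡0 x∈allVecs x∈Lp

frac≡0⇒≡0 : ∀ n d → d ≢ 0 → frac n d ≡ 0ℚ → n ≡ 0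
frac≡0⇒≡0 n zero    d≢0 _ = contradiction refl d≢0
frac≡0⇒≡0 n (suc d) _   frac≡0 = ℤP.+-injective (begin
  + n                             ≡⟨ ↥-/ (+ n) (suc d) ⟨
  ↥ (+ n ℚ./ suc d) * g           ≡⟨ cong (_* g) (p≡0⇒↥p≡0 _ frac≡0) ⟩
  0ℤ * g                          ≡⟨ *-zeroˡ g ⟩
  0ℤ                              ∎)
  where
  open ≡-Reasoning
  g = gcd (+ n) (+ suc d)

m^n*k≡0⇒k≡0 : ∀ m n {k} → m ≢ 0 → m ℕ.^ n ℕ.* k ≡ 0 → k ≡ 0
m^n*k≡0⇒k≡0 m n m≢0 e with ℕP.m*n≡0⇒m≡0∨n≡0 (m ℕ.^ n) e
... | inj₁ m^n≡0 = contradiction (ℕP.m^n≡0⇒m≡0 m n m^n≡0) m≢0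
... | inj₂ k≡0   = k≡0

αnd≡0⇒cardLpUnits≡0 : ∀ p .{{_ : ℕ.NonTrivial p}} (a : Vec ℤ t) (gs : Vec (Vec ℤ t) k) →
  αnd p a gs ≡ 0ℚ → cardLpUnits p a gs ≡ 0
αnd≡0⇒cardLpUnits≡0 {t = t} p a gs αnd≡0 =
  m^n*k≡0⇒k≡0 p t (ℕ.≢-nonZero⁻¹ p) (frac≡0⇒≡0 _ _ denominator≢0 αnd≡0)
  where
  instance _ = ℕ.nonTrivial⇒nonZero p
  p∸1≢0 : p ℕ.∸ 1 ≢ 0
  p∸1≢0 = ℕP.>⇒≢ (ℕP.m<n⇒0<n∸m (ℕ.nonTrivial⇒n>1 p))
  denominator≢0 : (p ℕ.∸ 1) ℕ.^ t ℕ.* cardLp p a gs ≢ 0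
  denominator≢0 = cardLp≢0 p a gs ∘ m^n*k≡0⇒k≡0 (p ℕ.∸ 1) t p∸1≢0

noUnitsInLp : ∀ p .{{_ : NonZero p}} (a : Vec ℤ t) (gs : Vec (Vec ℤ t) k) {c : Vec ℕ k} →
  cardLpUnits p a gs ≡ 0 → VAll.All (ℕ._< p) c →
  ¬ T (unitVec (redV p (a +ᵥ lincomb (Vec.map +_ c) gs)))
noUnitsInLp p a gs units≡0 c<p unit =
  let x∈allVecs , x∈Lp = reduced-∈Lp p a gs c<p
  in countB≡0⇒¬T _ _ units≡0 x∈allVecs (Equivalence.from T-∧ (x∈Lp , unit))

¬unitVec⇒zero : (v : Vec ℕ t) → ¬ T (unitVec v) → ∃ λ j → lookup v j ≡ 0
¬unitVec⇒zero []      ¬unit = contradiction tt ¬unit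
¬unitVec⇒zero (zero  ∷ v) ¬unit = zero , refl
¬unitVec⇒zero (suc _ ∷ v) ¬unit = let j , vⱼ≡0 = ¬unitVec⇒zero v ¬unit in suc j , vⱼ≡0

α≡0⇒keptCoordinateDivisible : ∀ p .{{_ : ℕ.NonTrivial p}} (a : Vec ℤ t) (gs : Vec (Vec ℤ t) k) {x} →
  α p a gs ≡ 0ℚ → InL a gs x → ∃ λ i → T (lookup (keepVec a gs) i) × + p ∣ lookup x i
α≡0⇒keptCoordinateDivisible p a gs α≡0 (cs , refl) =
  let j , x*ⱼ%p≡0      = ¬unitVec⇒zero (redV p (proj bs x′)) x*-not-unit
      i , kept , x*ⱼ≡x′ᵢ = lookup-proj bs x′ j
      x′ᵢ%p≡0 = begin
        modP p (lookup x′ i)              ≡⟨ cong (modP p) x*ⱼ≡x′ᵢ ⟨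
        modP p (lookup (proj bs x′) j)    ≡⟨ VP.lookup-map j (modP p) (proj bs x′) ⟨
        lookup (redV p (proj bs x′)) j    ≡⟨ x*ⱼ%p≡0 ⟩
        0                                 ∎
  in i , kept , ∣-affine-redV p a cs gs i (modP≡0⇒∣ p (lookup x′ i) x′ᵢ%p≡0)
  where
  open ≡-Reasoning
  instance _ = ℕ.nonTrivial⇒nonZero p
  bs = keepVec a gs
  -- Reducing the coefficients of x mod p gives x′ ≡ x (mod p), and the reduction of the
  -- projection of x′ is one of the points that LpList enumerates for L*.
  c  = redV p cs
  x′ = a +ᵥ lincomb (Vec.map +_ c) gs
  x*-not-unit : ¬ T (unitVec (redV p (proj bs x′)))
  x*-not-unit = subst (λ y → ¬ T (unitVec (redV p y))) (sym (proj-affine bs a (Vec.map +_ c) gs))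
    (noUnitsInLp p (proj bs a) (Vec.map (proj bs) gs)
      (αnd≡0⇒cardLpUnits≡0 p (proj bs a) (Vec.map (proj bs) gs) α≡0) (redV-< p cs))

p∣𝒫⇒∣z∣≡p : ∀ {p z} → Prime p → IsP z → + p ∣ z → ∣ z ∣ ≡ p
p∣𝒫⇒∣z∣≡p pp z∈𝒫 p∣z with prime⇒irreducible z∈𝒫 (∣⇒∣ᵤ p∣z)
... | inj₁ p≡1    = contradiction p≡1 (ℕ.nonTrivial⇒≢1 {{prime⇒nonTrivial pp}})
... | inj₂ p≡∣z∣ = sym p≡∣z∣

large-multiple-avoids : ∀ N w v P → w ≢ 0ℤ → ∣ v ∣ ℕ.+ P ℕ.< N → ∣ + N * w + v ∣ ≢ P
large-multiple-avoids N w v P w≢0 small ∣Nw+v∣≡P = ℕP.<⇒≱ small (begin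
  N                            ≤⟨ ℕP.m≤m*n N ∣ w ∣ {{ℕ.≢-nonZero (w≢0 ∘ ℤP.∣i∣≡0⇒i≡0)}} ⟩
  N ℕ.* ∣ w ∣                  ≡⟨ ℤP.abs-* (+ N) w ⟨
  ∣ + N * w ∣                  ≡⟨ cong ∣_∣ (ℤP.+-identityʳ (+ N * w)) ⟨
  ∣ + N * w + 0ℤ ∣             ≡⟨ cong (λ z → ∣ + N * w + z ∣) (ℤP.+-inverseʳ v) ⟨
  ∣ + N * w + (v - v) ∣        ≡⟨ cong ∣_∣ (ℤP.+-assoc (+ N * w) v (- v)) ⟨
  ∣ + N * w + v - v ∣          ≤⟨ ℤP.∣i-j∣≤∣i∣+∣j∣ (+ N * w + v) v ⟩
  ∣ + N * w + v ∣ ℕ.+ ∣ v ∣    ≡⟨ cong (ℕ._+ ∣ v ∣) ∣Nw+v∣≡P ⟩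
  P ℕ.+ ∣ v ∣                  ≡⟨ ℕP.+-comm P ∣ v ∣ ⟩
  ∣ v ∣ ℕ.+ P                  ∎)
  where open ℕP.≤-Reasoning

avoid-∷ : ∀ N (cs : Vec ℤ k) (b : ℤ) (w : Vec ℤ (suc k)) P →
  (Vec.head w ≡ 0ℤ → ∣ b + dot cs (Vec.tail w) ∣ ≢ P) →
  ∣ b + dot cs (Vec.tail w) ∣ ℕ.+ P ℕ.< N →
  ∣ b + dot (+ N ∷ cs) w ∣ ≢ P
avoid-∷ N cs b (w₀ ∷ ws) P avoids-if-w₀≡0 small with w₀ ℤ.≟ 0ℤ
... | yes refl = subst (λ z → ∣ b + z ∣ ≢ P) (sym N*0+d≡d) (avoids-if-w₀≡0 refl)
  where
  N*0+d≡d : + N * 0ℤ + dot cs ws ≡ dot cs ws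
  N*0+d≡d = trans (cong (_+ dot cs ws) (*-zeroʳ (+ N))) (ℤP.+-identityˡ (dot cs ws))
... | no w₀≢0  = subst (λ z → ∣ z ∣ ≢ P) (x+[y+z]≡y+[x+z] (+ N * w₀) b (dot cs ws))
                   (large-multiple-avoids N w₀ (b + dot cs ws) P w₀≢0 small)

-- The later coefficients are chosen recursively, for the constraints whose first weight is 0;
-- a first coefficient N beyond every remaining |value| + P then takes care of the others.
avoid : ∀ {m} P (b : Fin m → ℤ) (w : Fin m → Vec ℤ k) (K : Fin m → Set) →
  (∀ i → K i → w i ≡ 0ᵥ → ∣ b i ∣ ≢ P) →
  ∃ λ cs → ∀ i → K i → ∣ b i + dot cs (w i) ∣ ≢ P
avoid {k = zero} P b w K constant-avoids = [] , λ i Kᵢ → avoid-[] (b i) (w i) (constant-avoids i Kᵢ)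
  where
  avoid-[] : ∀ b (w : Vec ℤ 0) → (w ≡ 0ᵥ → ∣ b ∣ ≢ P) → ∣ b + dot [] w ∣ ≢ P
  avoid-[] b [] avoids = subst (λ z → ∣ z ∣ ≢ P) (sym (ℤP.+-identityʳ b)) (avoids refl)
avoid {k = suc k} P b w K constant-avoids =
  + N ∷ cs , λ i Kᵢ → avoid-∷ N cs (b i) (w i) P (λ w₀≡0 → tail-avoids i (Kᵢ , w₀≡0)) (size<N i)
  where
  K′ : Fin _ → Set
  K′ i = K i × Vec.head (w i) ≡ 0ℤ
  constant-avoids′ : ∀ i → K′ i → Vec.tail (w i) ≡ 0ᵥ → ∣ b i ∣ ≢ P
  constant-avoids′ i (Kᵢ , w₀≡0) ws≡0 =
    constant-avoids i Kᵢ (head-tail-0ᵥ (w i) w₀≡0 ws≡0)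
    where
    head-tail-0ᵥ : (v : Vec ℤ (suc k)) → Vec.head v ≡ 0ℤ → Vec.tail v ≡ 0ᵥ → v ≡ 0ᵥ
    head-tail-0ᵥ (_ ∷ _) refl refl = refl
  recursive = avoid P b (Vec.tail ∘ w) K′ constant-avoids′
  cs = proj₁ recursive
  tail-avoids = proj₂ recursive
  size : Fin _ → ℕ
  size i = ∣ b i + dot cs (Vec.tail (w i)) ∣ ℕ.+ P
  N = suc (max 0 (List.tabulate size))
  size<N : ∀ i → size i ℕ.< N
  size<N i = ℕ.s≤s (LAll.lookup (xs≤max 0 (List.tabulate size)) (∈-tabulate⁺ i))

constCoord-zeroColumn : (gs : Vec (Vec ℤ t) k) (i : Fin t) → column gs i ≡ 0ᵥ → T (constCoord gs i)
constCoord-zeroColumn []       i refl    = tt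
constCoord-zeroColumn (g ∷ gs) i col≡0 =
  let gᵢ≡0 , col′≡0 = VP.∷-injective col≡0
  in Equivalence.from T-∧ (Equivalence.from T-≡ (dec-true (lookup g i ℤ.≟ 0ℤ) gᵢ≡0) ,
                           constCoord-zeroColumn gs i col′≡0)

zeroColumn⇒1<t : (gs : Vec (Vec ℤ t) k) (i : Fin t) → NonTrivial gs → column gs i ≡ 0ᵥ → 1 ℕ.< t
zeroColumn⇒1<t {t = suc (suc _)} gs i _ _ = ℕ.s≤s (ℕ.s≤s ℕ.z≤n)
zeroColumn⇒1<t {t = suc zero} gs zero (y , (cs , y≡lincomb) , y≢0) col≡0 =
  contradiction (singleton-0ᵥ y y₀≡0) y≢0
  where
  open ≡-Reasoning
  y₀≡0 : lookup y zero ≡ 0ℤ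
  y₀≡0 = begin
    lookup y zero                ≡⟨ cong (λ v → lookup v zero) y≡lincomb ⟩
    lookup (lincomb cs gs) zero  ≡⟨ lookup-lincomb cs gs zero ⟩
    dot cs (column gs zero)      ≡⟨ cong (dot cs) col≡0 ⟩
    dot cs 0ᵥ                    ≡⟨ dot-0ᵥ cs ⟩
    0ℤ                           ∎
  singleton-0ᵥ : (v : Vec ℤ 1) → lookup v zero ≡ 0ℤ → v ≡ 0ᵥ
  singleton-0ᵥ (_ ∷ []) refl = refl

keptConstant-avoids : ∀ {p} → Prime p → (a : Vec ℤ t) (gs : Vec (Vec ℤ t) k) → NonTrivial gs →
  ∀ i → T (lookup (keepVec a gs) i) → column gs i ≡ 0ᵥ → ∣ lookup a i ∣ ≢ p
keptConstant-avoids {t = t} pp a gs nt i kept col≡0 ∣aᵢ∣≡p =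
  subst T (Equivalence.to T-not-≡ (subst T (VP.lookup∘tabulate (λ i → not (inA a gs i)) i) kept)) i∈A
  where
  i∈A : T (inA a gs i)
  i∈A = Equivalence.from T-∧
    ( Equivalence.from T-≡ (dec-true (1 ℕ.<? t) (zeroColumn⇒1<t gs i nt col≡0))
    , Equivalence.from T-∧
      ( constCoord-zeroColumn gs i col≡0
      , Equivalence.from T-≡ (dec-true (prime? ∣ lookup a i ∣) (subst Prime (sym ∣aᵢ∣≡p) pp))))

avoidingPoint : ∀ {p} → Prime p → (a : Vec ℤ t) (gs : Vec (Vec ℤ t) k) → NonTrivial gs →
  ∃ λ y → InL a gs y × (∀ i → T (lookup (keepVec a gs) i) → ∣ lookup y i ∣ ≢ p)
avoidingPoint {p = p} pp a gs nt =
  let cs , avoids = avoid p (lookup a) (column gs) (λ i → T (lookup (keepVec a gs) i))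
                          (keptConstant-avoids pp a gs nt)
  in a +ᵥ lincomb cs gs , (cs , refl) ,
     λ i kept → subst (λ z → ∣ z ∣ ≢ p) (sym (lookup-affine a cs gs i)) (avoids i kept)

mainTheorem1 : (t : ℕ) → 1 ≤ t → {k : ℕ} (a : Vec ℤ t) (gs : Vec (Vec ℤ t) k)
    → NonTrivial gs
    → ZariskiDense (λ x → InL a gs x × AllP x) (InL a gs)
    → (p : ℕ) → Prime p → α p a gs ≢ 0ℚ
mainTheorem1 t _ a gs nt dense p pp α≡0 =
  let y , y∈L , y-avoids = avoidingPoint pp a gs nt
  in ∏xᵢ²-p²≢0 p bs y y-avoids (dense F vanishes-on-L∩𝒫ᵗ y y∈L (∏xᵢ²-p² p bs) refl)
  where
  instance _ = prime⇒nonTrivial pp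
  bs = keepVec a gs
  F : Poly t → Set
  F f = f ≡ ∏xᵢ²-p² p bs
  vanishes-on-L∩𝒫ᵗ : ∀ x → InL a gs x × AllP x → ZeroSet F x
  vanishes-on-L∩𝒫ᵗ x (x∈L , x∈𝒫ᵗ) _ refl =
    let i , kept , p∣xᵢ = α≡0⇒keptCoordinateDivisible p a gs α≡0 x∈L
    in ∏xᵢ²-p²-root p bs x i kept (p∣𝒫⇒∣z∣≡p pp (x∈𝒫ᵗ i) p∣xᵢ)
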